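{- Let $n$ be a positive integer. Every (not necessarily homogeneous) $\Sigma\Pi\Sigma$ circuit over $\mathrm{GF}(2)$ computing $S^2_n(X_1,\dots,X_n)$ has at least $\lceil \frac{n}{2}\rceil$ multiplication gates if $n \equiv 0,2,3 \pmod 4$, and at least $\lfloor \frac{n}{2}\rfloor$ multiplication gates if $n \equiv 1 \pmod 4$.
   Context: $S_n^2(X_1,\dots,X_n) = \sum_{1\le i<j\le n} X_iX_j$. A $\Sigma\Pi\Sigma$ circuit over a field $\mathbb{F}$ in variables $X_1,\dots,X_n$ is an expression $\sum_{i=1}^r \prod_{j=1}^{s_i} L_{ij}(X)$ where each $L_{ij}$ is a linear form $a_0+\sum_{k=1}^n a_kX_k$ with $a_0,\dots,a_n\in\mathbb{F}$ (constant terms allowed); $r$ is its number of multiplication gates. It computes a polynomial $P$ if the expression equals $P$ in $\mathbb{F}[X_1,\dots,X_n]$. -}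

module Defs where

open import Data.Bool using (Bool; true; false; if_then_else_; _xor_)
open import Data.Nat using (ℕ; zero; suc; _+_; _%_; _≡ᵇ_; ⌊_/2⌋; ⌈_/2⌉)
open import Data.Fin using (Fin; _<?_)
import Data.Fin as Fin
open import Data.List using (List; []; _∷_; _++_; concatMap; map; length)
open import Data.Vec using (Vec; tabulate; replicate; zipWith)
open import Data.Vec.Properties using (≡-dec)
import Data.Nat.Properties as ℕP
open import Data.List using (allFin)
open import Relation.Nullary using (yes; no; does)
open import Relation.Binary.PropositionalEquality using (_≡_)

-- A monomial is its exponent vector; a polynomial is represented by a
-- list of monomials, read as their sum over GF(2): the coefficient of a
-- monomial is the parity of its number of occurrences.  Two lists denote
-- the same element of GF(2)[X_1..X_n] iff all coefficients agree.
Monomial : ℕ → Set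
Monomial n = Vec ℕ n

Poly : ℕ → Set
Poly n = List (Monomial n)

coeff : ∀ {n} → Monomial n → Poly n → Bool
coeff m [] = false
coeff m (x ∷ p) = does (≡-dec ℕP._≟_ m x) xor coeff m p

_≈P_ : ∀ {n} → Poly n → Poly n → Set
_≈P_ {n} p q = (m : Monomial n) → coeff m p ≡ coeff m q

one : ∀ {n} → Poly n
one {n} = replicate n 0 ∷ []

_⊕_ : ∀ {n} → Poly n → Poly n → Poly n
p ⊕ q = p ++ q

_⊗_ : ∀ {n} → Poly n → Poly n → Poly n
p ⊗ q = concatMap (λ a → map (λ b → zipWith _+_ a b) q) p

var : ∀ {n} → Fin n → Monomial n
var k = tabulate (λ i → if does (i Fin.≟ k) then 1 else 0)

record LinForm (n : ℕ) : Set where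
  constructor linForm
  field
    const : Bool
    coeffs : Fin n → Bool

evalLin : ∀ {n} → LinForm n → Poly n
evalLin {n} (linForm a₀ a) =
  (if a₀ then one else []) ++
  concatMap (λ k → if a k then var k ∷ [] else []) (allFin n)

Circuit : ℕ → Set
Circuit n = List (List (LinForm n))

gates : ∀ {n} → Circuit n → ℕ
gates = length

evalGate : ∀ {n} → List (LinForm n) → Poly n
evalGate [] = one
evalGate (L ∷ Ls) = evalLin L ⊗ evalGate Ls

evalCircuit : ∀ {n} → Circuit n → Poly n
evalCircuit [] = []
evalCircuit (g ∷ C) = evalGate g ⊕ evalCircuit C

Computes : ∀ {n} → Circuit n → Poly n → Set
Computes C P = evalCircuit C ≈P P

S2 : (n : ℕ) → Poly n
S2 n = concatMap (λ i → concatMap (λ j →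
         if does (i <? j) then zipWith _+_ (var i) (var j) ∷ [] else [])
         (allFin n)) (allFin n)

bound : ℕ → ℕ
bound n = if (n % 4) ≡ᵇ 1 then ⌊ n /2⌋ else ⌈ n /2⌉

-- A ΣΠΣ circuit over GF(2) with r gates computing S²ₙ makes S²ₙ constant on an affine
-- subspace b + span A of dimension at least n − r: gate by gate, either every linear form
-- of the gate is constant on the current subspace, or one is not and we restrict to the
-- hyperplane where it vanishes.  Constancy forces the polar form
-- β(x, y) = x·y + (Σx)(Σy) of S²ₙ to vanish on span A.  As β(x, y) = x · (y + (Σy)𝟏),
-- span A is orthogonal to its image under y ↦ y + (Σy)𝟏, which is injective on span A
-- unless 𝟏 ∈ span A and n is odd; so 2 dim ≤ n.  In the remaining case n ≡ 3 (mod 4) is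
-- impossible, since S²ₙ(b + 𝟏) = S²ₙ(b) + 1, and for n ≡ 1 (mod 4) removing one basis
-- vector used by 𝟏 gives 2 (dim − 1) ≤ n.

module Submission where

open import Defs
open import Data.Bool using (Bool; true; false; _xor_; _∧_; not; if_then_else_)
open import Data.Bool.Properties
  using (xor-same; xor-comm; xor-assoc; xor-identityʳ; ∧-distribˡ-xor; ∧-distribʳ-xor;
         ∧-zeroʳ; ∧-identityʳ; ∧-comm; ∧-assoc; not-involutive; ¬-not; xor-∧-commutativeRing)
  renaming (_≟_ to _≟ᵇ_)
open import Data.Empty using (⊥-elim)
open import Data.Fin using (Fin; zero; suc; punchIn; _<?_)
import Data.Fin as Fin
open import Data.Fin.Properties using (any?; all?; punchIn-punchOut; punchInᵢ≢i)
open import Data.Maybe using (just; nothing)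
open import Data.Nat using (ℕ; zero; suc; _+_; _≤_; z≤n; s≤s; _%_; _≡ᵇ_; ⌊_/2⌋; ⌈_/2⌉)
open import Data.Nat.DivMod using ([m+n]%n≡m%n)
import Data.Nat.Properties as ℕ
import Data.Vec as Vec
import Data.Vec.Properties as Vec
open import Data.Fin.Subset.Properties using (anySubset?)
open import Data.Product using (Σ; ∃; ∃₂; _×_; _,_)
open import Data.Vec.Functional using (insertAt)
open import Data.Vec.Functional.Properties using (insertAt-lookup; insertAt-punchIn)
open import Data.List using (List; []; _∷_; _++_; length; map; concatMap; allFin)
import Data.List as List
open import Data.List.Properties using (length-++-sucʳ)
open import Data.Vec using ([]; _∷_; zipWith; replicate; tabulate)
open import Data.Vec.Properties using (≡-dec)
open import Function using (_∘_)
open import Relation.Nullary using (¬_; Dec; yes; no; does)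
open import Relation.Nullary.Decidable using (dec-true; dec-false)
open import Relation.Binary.PropositionalEquality
open import Tactic.RingSolver using (solve-∀)
open import Tactic.RingSolver.Core.AlmostCommutativeRing using (AlmostCommutativeRing; fromCommutativeRing)

𝔽₂ : AlmostCommutativeRing _ _
𝔽₂ = fromCommutativeRing xor-∧-commutativeRing λ { false → just refl ; true → nothing }

Bits : ℕ → Set
Bits n = Fin n → Bool

⨁ : ∀ {m} → (Fin m → Bool) → Bool
⨁ {zero}  f = false
⨁ {suc m} f = f zero xor ⨁ (f ∘ suc)

xor-interchange : ∀ a b c d → (a xor b) xor (c xor d) ≡ (a xor c) xor (b xor d)
xor-interchange = solve-∀ 𝔽₂

xor-exchange : ∀ a b c → a xor (b xor c) ≡ b xor (a xor c)
xor-exchange = solve-∀ 𝔽₂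

∧-exchange : ∀ a b c → a ∧ (b ∧ c) ≡ b ∧ (a ∧ c)
∧-exchange = solve-∀ 𝔽₂

∧-interchange : ∀ a b c d → (a ∧ b) ∧ (c ∧ d) ≡ (a ∧ c) ∧ (b ∧ d)
∧-interchange = solve-∀ 𝔽₂

xor-cancelˡ : ∀ a b c → a xor (b xor (a xor c)) ≡ b xor c
xor-cancelˡ a b c = begin
  a xor (b xor (a xor c))  ≡⟨ xor-exchange a b (a xor c) ⟩
  b xor (a xor (a xor c))  ≡⟨ cong (b xor_) (sym (xor-assoc a a c)) ⟩
  b xor ((a xor a) xor c)  ≡⟨ cong (λ z → b xor (z xor c)) (xor-same a) ⟩
  b xor c                  ∎
  where open ≡-Reasoning

true≢false : true ≢ false
true≢false ()

xor≡false⇒≡ : ∀ {a b} → a xor b ≡ false → a ≡ b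
xor≡false⇒≡ {false} {false} _ = refl
xor≡false⇒≡ {true}  {true}  _ = refl

∧-vanishes : ∀ {a b} → b ≡ false → a ∧ b ≡ false
∧-vanishes {a} refl = ∧-zeroʳ a

xor-cancel-∧ : ∀ a → a xor (a ∧ true) ≡ false
xor-cancel-∧ a = trans (cong (a xor_) (∧-identityʳ a)) (xor-same a)

⨁-cong : ∀ {m} {f g : Fin m → Bool} → f ≗ g → ⨁ f ≡ ⨁ g
⨁-cong {zero}  e = refl
⨁-cong {suc m} e = cong₂ _xor_ (e zero) (⨁-cong (e ∘ suc))

⨁-zero : ∀ {m} {f : Fin m → Bool} → (∀ i → f i ≡ false) → ⨁ f ≡ false
⨁-zero {zero}  e = refl
⨁-zero {suc m} e rewrite e zero = ⨁-zero (e ∘ suc)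

⨁-xor : ∀ {m} (f g : Fin m → Bool) → ⨁ (λ i → f i xor g i) ≡ ⨁ f xor ⨁ g
⨁-xor {zero}  f g = refl
⨁-xor {suc m} f g =
  trans (cong ((f zero xor g zero) xor_) (⨁-xor (f ∘ suc) (g ∘ suc)))
        (xor-interchange (f zero) (g zero) (⨁ (f ∘ suc)) (⨁ (g ∘ suc)))

⨁-∧ˡ : ∀ {m} c (f : Fin m → Bool) → ⨁ (λ i → c ∧ f i) ≡ c ∧ ⨁ f
⨁-∧ˡ {zero}  c f = sym (∧-zeroʳ c)
⨁-∧ˡ {suc m} c f = trans (cong ((c ∧ f zero) xor_) (⨁-∧ˡ c (f ∘ suc)))
                         (sym (∧-distribˡ-xor c (f zero) (⨁ (f ∘ suc))))

⨁-∧ʳ : ∀ {m} c (f : Fin m → Bool) → ⨁ (λ i → f i ∧ c) ≡ ⨁ f ∧ c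
⨁-∧ʳ c f = trans (⨁-cong (λ i → ∧-comm (f i) c)) (trans (⨁-∧ˡ c f) (∧-comm c (⨁ f)))

⨁-swap : ∀ {m n} (f : Fin m → Fin n → Bool) → ⨁ (λ i → ⨁ (f i)) ≡ ⨁ (λ j → ⨁ (λ i → f i j))
⨁-swap {zero} {n} f = sym (⨁-zero {n} (λ _ → refl))
⨁-swap {suc m} f = trans (cong (⨁ (f zero) xor_) (⨁-swap (f ∘ suc)))
                         (sym (⨁-xor (f zero) (λ j → ⨁ (λ i → f (suc i) j))))

⨁-punchIn : ∀ {m} (k : Fin (suc m)) (f : Fin (suc m) → Bool) → ⨁ f ≡ f k xor ⨁ (f ∘ punchIn k)
⨁-punchIn zero            f = refl
⨁-punchIn {suc m} (suc k) f = begin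
  f zero xor ⨁ (f ∘ suc)                               ≡⟨ cong (f zero xor_) (⨁-punchIn k (f ∘ suc)) ⟩
  f zero xor (f (suc k) xor ⨁ (f ∘ suc ∘ punchIn k))   ≡⟨ xor-exchange (f zero) (f (suc k)) _ ⟩
  f (suc k) xor (f zero xor ⨁ (f ∘ suc ∘ punchIn k))   ∎
  where open ≡-Reasoning

δ : ∀ {m} → Fin m → Fin m → Bool
δ i j = does (i Fin.≟ j)

⨁-δ : ∀ {m} (i : Fin m) (f : Fin m → Bool) → ⨁ (λ j → δ i j ∧ f j) ≡ f i
⨁-δ {suc m} i f = begin
  ⨁ (λ j → δ i j ∧ f j)                                           ≡⟨ ⨁-punchIn i (λ j → δ i j ∧ f j) ⟩
  (δ i i ∧ f i) xor ⨁ (λ j → δ i (punchIn i j) ∧ f (punchIn i j))  ≡⟨ cong₂ _xor_ diagonal (⨁-zero off-diagonal) ⟩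
  f i xor false                                                   ≡⟨ xor-identityʳ (f i) ⟩
  f i                                                             ∎
  where
  open ≡-Reasoning
  diagonal : δ i i ∧ f i ≡ f i
  diagonal = cong (_∧ f i) (dec-true (i Fin.≟ i) refl)
  off-diagonal : ∀ j → δ i (punchIn i j) ∧ f (punchIn i j) ≡ false
  off-diagonal j = cong (_∧ f (punchIn i j)) (dec-false (i Fin.≟ punchIn i j) (punchInᵢ≢i i j ∘ sym))

infixl 6 _⊻_
infixr 7 _⋆_
infix  5 _·_

𝟎 : ∀ {n} → Bits n
𝟎 _ = false

_⊻_ : ∀ {n} → Bits n → Bits n → Bits n
(x ⊻ y) i = x i xor y i

_⋆_ : ∀ {n} → Bool → Bits n → Bits n
(c ⋆ x) i = c ∧ x i

_·_ : ∀ {n} → Bits n → Bits n → Bool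
a · v = ⨁ (λ i → a i ∧ v i)

lincomb : ∀ {m n} → Bits m → (Fin m → Bits n) → Bits n
lincomb S A i = ⨁ (λ j → S j ∧ A j i)

Independent : ∀ {m n} → (Fin m → Bits n) → Set
Independent {m} A = (S : Bits m) → lincomb S A ≗ 𝟎 → S ≗ 𝟎

·-comm : ∀ {n} (a v : Bits n) → (a · v) ≡ (v · a)
·-comm a v = ⨁-cong (λ i → ∧-comm (a i) (v i))

·-⊻ʳ : ∀ {n} (a x y : Bits n) → (a · x ⊻ y) ≡ (a · x) xor (a · y)
·-⊻ʳ a x y = trans (⨁-cong (λ i → ∧-distribˡ-xor (a i) (x i) (y i)))
                   (⨁-xor (λ i → a i ∧ x i) (λ i → a i ∧ y i))

·-⋆ʳ : ∀ {n} (a : Bits n) c x → (a · c ⋆ x) ≡ c ∧ (a · x)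
·-⋆ʳ a c x = trans (⨁-cong (λ i → ∧-exchange (a i) c (x i))) (⨁-∧ˡ c (λ i → a i ∧ x i))

·-⊻ˡ : ∀ {n} (x y v : Bits n) → (x ⊻ y · v) ≡ (x · v) xor (y · v)
·-⊻ˡ x y v = trans (·-comm (x ⊻ y) v) (trans (·-⊻ʳ v x y) (cong₂ _xor_ (·-comm v x) (·-comm v y)))

·-⋆ˡ : ∀ {n} c (x v : Bits n) → (c ⋆ x · v) ≡ c ∧ (x · v)
·-⋆ˡ c x v = trans (·-comm (c ⋆ x) v) (trans (·-⋆ʳ v c x) (cong (c ∧_) (·-comm v x)))

·-lincomb : ∀ {m n} (a : Bits n) (S : Bits m) (A : Fin m → Bits n) →
            (a · lincomb S A) ≡ ⨁ (λ j → S j ∧ (a · A j))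
·-lincomb a S A = begin
  ⨁ (λ i → a i ∧ ⨁ (λ j → S j ∧ A j i))      ≡⟨ ⨁-cong (λ i → sym (⨁-∧ˡ (a i) (λ j → S j ∧ A j i))) ⟩
  ⨁ (λ i → ⨁ (λ j → a i ∧ (S j ∧ A j i)))    ≡⟨ ⨁-swap (λ i j → a i ∧ (S j ∧ A j i)) ⟩
  ⨁ (λ j → ⨁ (λ i → a i ∧ (S j ∧ A j i)))    ≡⟨ ⨁-cong (λ j → ·-⋆ʳ a (S j) (A j)) ⟩
  ⨁ (λ j → S j ∧ (a · A j))                  ∎
  where open ≡-Reasoning

module _ {m n : ℕ} (A : Fin m → Bits n) where

  lincomb-cong : {S T : Bits m} → S ≗ T → lincomb S A ≗ lincomb T A
  lincomb-cong S≗T i = ⨁-cong (λ j → cong (_∧ A j i) (S≗T j))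

  lincomb-𝟎 : lincomb 𝟎 A ≗ 𝟎
  lincomb-𝟎 i = ⨁-zero {m} (λ _ → refl)

  lincomb-δ : ∀ j → lincomb (δ j) A ≗ A j
  lincomb-δ j i = ⨁-δ j (λ k → A k i)

  lincomb-⊻ : ∀ S T → lincomb (S ⊻ T) A ≗ lincomb S A ⊻ lincomb T A
  lincomb-⊻ S T i = trans (⨁-cong (λ j → ∧-distribʳ-xor (A j i) (S j) (T j)))
                          (⨁-xor (λ j → S j ∧ A j i) (λ j → T j ∧ A j i))

lincomb-insertAt : ∀ {m n} (A : Fin (suc m) → Bits n) k S x →
                   lincomb (insertAt S k x) A ≗ (x ⋆ A k) ⊻ lincomb S (A ∘ punchIn k)
lincomb-insertAt A k S x i = begin
  ⨁ (λ j → insertAt S k x j ∧ A j i)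
    ≡⟨ ⨁-punchIn k (λ j → insertAt S k x j ∧ A j i) ⟩
  (insertAt S k x k ∧ A k i) xor ⨁ (λ j → insertAt S k x (punchIn k j) ∧ A (punchIn k j) i)
    ≡⟨ cong₂ _xor_ (cong (_∧ A k i) (insertAt-lookup S k x))
                   (⨁-cong (λ j → cong (_∧ A (punchIn k j) i) (insertAt-punchIn S k x j))) ⟩
  (x ∧ A k i) xor lincomb S (A ∘ punchIn k) i
    ∎
  where open ≡-Reasoning

eliminate : ∀ {m n} → (Fin (suc m) → Bits n) → Fin (suc m) → Bits m → Fin m → Bits n
eliminate A k c j = A (punchIn k j) ⊻ (c j ⋆ A k)

lincomb-eliminate : ∀ {m n} (A : Fin (suc m) → Bits n) k c S →
                    lincomb S (eliminate A k c) ≗ lincomb (insertAt S k (S · c)) A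
lincomb-eliminate A k c S i = begin
  ⨁ (λ j → S j ∧ (A (punchIn k j) i xor (c j ∧ A k i)))
    ≡⟨ ⨁-cong (λ j → ∧-distribˡ-xor (S j) (A (punchIn k j) i) (c j ∧ A k i)) ⟩
  ⨁ (λ j → (S j ∧ A (punchIn k j) i) xor (S j ∧ (c j ∧ A k i)))
    ≡⟨ ⨁-xor (λ j → S j ∧ A (punchIn k j) i) (λ j → S j ∧ (c j ∧ A k i)) ⟩
  lincomb S (A ∘ punchIn k) i xor ⨁ (λ j → S j ∧ (c j ∧ A k i))
    ≡⟨ cong (lincomb S (A ∘ punchIn k) i xor_) pivot-term ⟩
  lincomb S (A ∘ punchIn k) i xor ((S · c) ∧ A k i)
    ≡⟨ xor-comm (lincomb S (A ∘ punchIn k) i) ((S · c) ∧ A k i) ⟩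
  ((S · c) ∧ A k i) xor lincomb S (A ∘ punchIn k) i
    ≡⟨ sym (lincomb-insertAt A k S (S · c) i) ⟩
  lincomb (insertAt S k (S · c)) A i
    ∎
  where
  open ≡-Reasoning
  pivot-term : ⨁ (λ j → S j ∧ (c j ∧ A k i)) ≡ (S · c) ∧ A k i
  pivot-term = trans (⨁-cong (λ j → sym (∧-assoc (S j) (c j) (A k i)))) (⨁-∧ʳ (A k i) (λ j → S j ∧ c j))

module _ {m n : ℕ} (A : Fin (suc m) → Bits n) (indA : Independent A) (k : Fin (suc m)) where

  eliminate-independent : ∀ c → Independent (eliminate A k c)
  eliminate-independent c S comb≡𝟎 j = trans (sym (insertAt-punchIn S k (S · c) j))
    (indA (insertAt S k (S · c)) (λ i → trans (sym (lincomb-eliminate A k c S i)) (comb≡𝟎 i)) (punchIn k j))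

  punchIn-independent : Independent (A ∘ punchIn k)
  punchIn-independent S comb≡𝟎 j = trans (sym (insertAt-punchIn S k false j))
    (indA (insertAt S k false) (λ i → trans (lincomb-insertAt A k S false i) (comb≡𝟎 i)) (punchIn k j))

∀-punchIn : ∀ {n} {P : Fin (suc n) → Set} k → P k → (∀ i → P (punchIn k i)) → ∀ i → P i
∀-punchIn {P = P} k Pk P-rest i with k Fin.≟ i
... | yes refl = Pk
... | no k≢i   = subst P (punchIn-punchOut k≢i) (P-rest _)

dropCoordinate-independent : ∀ {m n} (A : Fin m → Bits (suc n)) k → (∀ j → A j k ≡ false) →
                             Independent A → Independent (λ j → A j ∘ punchIn k)
dropCoordinate-independent A k Ak≡0 indA S comb≡𝟎 =
  indA S (∀-punchIn k (⨁-zero (λ j → ∧-vanishes (Ak≡0 j))) comb≡𝟎)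

independent-nonzero : ∀ {m n} (A : Fin m → Bits n) → Independent A → ∀ j → ∃ λ k → A j k ≡ true
independent-nonzero A indA j with any? (λ k → A j k ≟ᵇ true)
... | yes found = found
... | no none   = ⊥-elim (true≢false (trans (sym (dec-true (j Fin.≟ j) refl)) (indA (δ j) Aj≡𝟎 j)))
  where
  Aj≡𝟎 : lincomb (δ j) A ≗ 𝟎
  Aj≡𝟎 i = trans (lincomb-δ A j i) (¬-not (λ Aji≡true → none (i , Aji≡true)))

reduceAt : ∀ {m n} → (Fin (suc m) → Bits (suc n)) → Fin (suc n) → Fin m → Bits n
reduceAt u k j = eliminate u zero (λ j → u (suc j) k) j ∘ punchIn k

module _ {m n : ℕ} (u : Fin (suc m) → Bits (suc n)) (k : Fin (suc n)) (pivot : u zero k ≡ true) where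

  pivotColumn-cleared : ∀ j → eliminate u zero (λ j → u (suc j) k) j k ≡ false
  pivotColumn-cleared j rewrite pivot = xor-cancel-∧ (u (suc j) k)

  reduceAt-independent : Independent u → Independent (reduceAt u k)
  reduceAt-independent indu =
    dropCoordinate-independent (eliminate u zero (λ j → u (suc j) k)) k pivotColumn-cleared
                               (eliminate-independent u indu zero (λ j → u (suc j) k))

independent⇒≤ : ∀ {m n} (A : Fin m → Bits n) → Independent A → m ≤ n
independent⇒≤ {zero}          A _ = z≤n
independent⇒≤ {suc m} {zero}  A indA with independent-nonzero A indA zero
... | () , _
independent⇒≤ {suc m} {suc n} A indA with independent-nonzero A indA zero
... | k , pivot = s≤s (independent⇒≤ (reduceAt A k) (reduceAt-independent A k pivot indA))

Orthogonal : ∀ {m m′ n} → (Fin m → Bits n) → (Fin m′ → Bits n) → Set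
Orthogonal u v = ∀ j l → (u j · v l) ≡ false

orthogonal⇒+≤ : ∀ {m m′ n} (u : Fin m → Bits n) (v : Fin m′ → Bits n) →
                Independent u → Independent v → Orthogonal u v → m + m′ ≤ n
orthogonal⇒+≤ {zero}            u v _ indv _ = independent⇒≤ v indv
orthogonal⇒+≤ {suc m} {n = zero} u v indu _ _ with independent-nonzero u indu zero
... | () , _
orthogonal⇒+≤ {suc m} {m′} {suc n} u v indu indv u⊥v with independent-nonzero u indu zero
... | k , pivot = s≤s (orthogonal⇒+≤ (reduceAt u k) v′ (reduceAt-independent u k pivot indu) indv′ u′⊥v′)
  where
  open ≡-Reasoning
  v′ : Fin m′ → Bits n
  v′ l = v l ∘ punchIn k

  -- A combination w of v is orthogonal to u zero, whose k-th coordinate is 1,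
  -- so w vanishes at k as soon as it vanishes off k.
  pivotCoordinate : ∀ S → lincomb S v′ ≗ 𝟎 → lincomb S v k ≡ false
  pivotCoordinate S w′≡𝟎 = begin
    lincomb S v k
      ≡⟨ sym (xor-identityʳ _) ⟩
    lincomb S v k xor false
      ≡⟨ cong₂ (λ a b → (a ∧ lincomb S v k) xor b) (sym pivot) (sym (⨁-zero (λ i → ∧-vanishes (w′≡𝟎 i)))) ⟩
    (u zero k ∧ lincomb S v k) xor ⨁ (λ i → u zero (punchIn k i) ∧ lincomb S v′ i)
      ≡⟨ sym (⨁-punchIn k (λ i → u zero i ∧ lincomb S v i)) ⟩
    (u zero · lincomb S v)
      ≡⟨ ·-lincomb (u zero) S v ⟩
    ⨁ (λ l → S l ∧ (u zero · v l))
      ≡⟨ ⨁-zero (λ l → ∧-vanishes (u⊥v zero l)) ⟩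
    false
      ∎

  indv′ : Independent v′
  indv′ S w′≡𝟎 = indv S (∀-punchIn k (pivotCoordinate S w′≡𝟎) w′≡𝟎)

  u′⊥v′ : Orthogonal (reduceAt u k) v′
  u′⊥v′ j l = begin
    (reduceAt u k j · v′ l)
      ≡⟨ cong (λ a → (a ∧ v l k) xor (reduceAt u k j · v′ l)) (sym (pivotColumn-cleared u k pivot j)) ⟩
    (eliminate u zero c j k ∧ v l k) xor (reduceAt u k j · v′ l)
      ≡⟨ sym (⨁-punchIn k (λ i → eliminate u zero c j i ∧ v l i)) ⟩
    (u (suc j) ⊻ c j ⋆ u zero · v l)
      ≡⟨ trans (·-⊻ˡ (u (suc j)) (c j ⋆ u zero) (v l)) (cong ((u (suc j) · v l) xor_) (·-⋆ˡ (c j) (u zero) (v l))) ⟩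
    (u (suc j) · v l) xor (c j ∧ (u zero · v l))
      ≡⟨ cong₂ (λ a b → a xor (c j ∧ b)) (u⊥v (suc j) l) (u⊥v zero l) ⟩
    c j ∧ false
      ≡⟨ ∧-zeroʳ (c j) ⟩
    false
      ∎
    where
    c : Bits m
    c j = u (suc j) k

_^ᵇ_ : Bool → ℕ → Bool
b ^ᵇ zero  = true
b ^ᵇ suc e = b ∧ b ^ᵇ e

⟦_⟧ₘ : ∀ {n} → Monomial n → Bits n → Bool
⟦ []     ⟧ₘ x = true
⟦ e ∷ es ⟧ₘ x = x zero ^ᵇ e ∧ ⟦ es ⟧ₘ (x ∘ suc)

⨁ₗ : {A : Set} → (A → Bool) → List A → Bool
⨁ₗ g []       = false
⨁ₗ g (a ∷ as) = g a xor ⨁ₗ g as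

⟦_⟧ : ∀ {n} → Poly n → Bits n → Bool
⟦ p ⟧ x = ⨁ₗ (λ m → ⟦ m ⟧ₘ x) p

⨁ₗ-++ : {A : Set} (g : A → Bool) (p q : List A) → ⨁ₗ g (p ++ q) ≡ ⨁ₗ g p xor ⨁ₗ g q
⨁ₗ-++ g []      q = refl
⨁ₗ-++ g (a ∷ p) q = trans (cong (g a xor_) (⨁ₗ-++ g p q)) (sym (xor-assoc (g a) (⨁ₗ g p) (⨁ₗ g q)))

coeff-++ : ∀ {n} (m : Monomial n) p q → coeff m (p ++ q) ≡ coeff m p xor coeff m q
coeff-++ m []      q = refl
coeff-++ m (y ∷ p) q = trans (cong ([m≡y] xor_) (coeff-++ m p q)) (sym (xor-assoc [m≡y] (coeff m p) (coeff m q)))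
  where [m≡y] = does (≡-dec ℕ._≟_ m y)

occurs-split : ∀ {n} (y : Monomial n) q → coeff y q ≡ true → ∃₂ λ q₁ q₂ → q ≡ q₁ ++ y ∷ q₂
occurs-split y (z ∷ q) occurs with ≡-dec ℕ._≟_ y z
... | yes refl = [] , q , refl
... | no _ with occurs-split y q occurs
...   | q₁ , q₂ , refl = z ∷ q₁ , q₂ , refl

-- Equal monomials cancel in pairs; the fuel k bounds the length of q.
⨁ₗ-coeff≡false : ∀ {n} (g : Monomial n → Bool) k q → length q ≤ k →
                 (∀ m → coeff m q ≡ false) → ⨁ₗ g q ≡ false
⨁ₗ-coeff≡false g k       []      _         _        = refl
⨁ₗ-coeff≡false g (suc k) (y ∷ q) (s≤s |q|≤k) coeffs≡0 with occurs-split y q y-occurs-again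
  where
  y-occurs-again : coeff y q ≡ true
  y-occurs-again = trans (sym (not-involutive _))
    (cong not (trans (cong (_xor coeff y q) (sym (dec-true (≡-dec ℕ._≟_ y y) refl))) (coeffs≡0 y)))
... | q₁ , q₂ , refl = begin
  g y xor ⨁ₗ g (q₁ ++ y ∷ q₂)                ≡⟨ cong (g y xor_) (⨁ₗ-++ g q₁ (y ∷ q₂)) ⟩
  g y xor (⨁ₗ g q₁ xor (g y xor ⨁ₗ g q₂))    ≡⟨ xor-cancelˡ (g y) (⨁ₗ g q₁) (⨁ₗ g q₂) ⟩
  ⨁ₗ g q₁ xor ⨁ₗ g q₂                        ≡⟨ sym (⨁ₗ-++ g q₁ q₂) ⟩
  ⨁ₗ g (q₁ ++ q₂)                            ≡⟨ ⨁ₗ-coeff≡false g k (q₁ ++ q₂) shorter remaining≡0 ⟩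
  false                                      ∎
  where
  open ≡-Reasoning
  shorter : length (q₁ ++ q₂) ≤ k
  shorter = ℕ.≤-trans (ℕ.n≤1+n _) (subst (_≤ k) (length-++-sucʳ q₁ y q₂) |q|≤k)
  remaining≡0 : ∀ m → coeff m (q₁ ++ q₂) ≡ false
  remaining≡0 m = begin
    coeff m (q₁ ++ q₂)                       ≡⟨ coeff-++ m q₁ q₂ ⟩
    coeff m q₁ xor coeff m q₂                ≡⟨ sym (xor-cancelˡ [m≡y] (coeff m q₁) (coeff m q₂)) ⟩
    [m≡y] xor (coeff m q₁ xor coeff m (y ∷ q₂)) ≡⟨ cong ([m≡y] xor_) (sym (coeff-++ m q₁ (y ∷ q₂))) ⟩
    coeff m (y ∷ q₁ ++ y ∷ q₂)               ≡⟨ coeffs≡0 m ⟩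
    false                                    ∎
    where [m≡y] = does (≡-dec ℕ._≟_ m y)

⟦⟧-≈ : ∀ {n} (p q : Poly n) → p ≈P q → ∀ x → ⟦ p ⟧ x ≡ ⟦ q ⟧ x
⟦⟧-≈ p q p≈q x = xor≡false⇒≡ (trans (sym (⨁ₗ-++ g p q)) (⨁ₗ-coeff≡false g _ (p ++ q) ℕ.≤-refl coeffs≡0))
  where
  g = λ m → ⟦ m ⟧ₘ x
  coeffs≡0 : ∀ m → coeff m (p ++ q) ≡ false
  coeffs≡0 m = trans (coeff-++ m p q) (trans (cong (_xor coeff m q) (p≈q m)) (xor-same (coeff m q)))

⟦⟧ₘ-cong : ∀ {n} (m : Monomial n) {x y : Bits n} → x ≗ y → ⟦ m ⟧ₘ x ≡ ⟦ m ⟧ₘ y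
⟦⟧ₘ-cong []       x≗y = refl
⟦⟧ₘ-cong (e ∷ es) x≗y = cong₂ (λ b r → b ^ᵇ e ∧ r) (x≗y zero) (⟦⟧ₘ-cong es (x≗y ∘ suc))

⟦⟧-cong : ∀ {n} (p : Poly n) {x y : Bits n} → x ≗ y → ⟦ p ⟧ x ≡ ⟦ p ⟧ y
⟦⟧-cong []      x≗y = refl
⟦⟧-cong (m ∷ p) x≗y = cong₂ _xor_ (⟦⟧ₘ-cong m x≗y) (⟦⟧-cong p x≗y)

⟦⟧-++ : ∀ {n} (p q : Poly n) x → ⟦ p ++ q ⟧ x ≡ ⟦ p ⟧ x xor ⟦ q ⟧ x
⟦⟧-++ p q x = ⨁ₗ-++ (λ m → ⟦ m ⟧ₘ x) p q

^ᵇ-+ : ∀ b e f → b ^ᵇ (e + f) ≡ b ^ᵇ e ∧ b ^ᵇ f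
^ᵇ-+ b zero    f = refl
^ᵇ-+ b (suc e) f = trans (cong (b ∧_) (^ᵇ-+ b e f)) (sym (∧-assoc b (b ^ᵇ e) (b ^ᵇ f)))

⟦zipWith-+⟧ₘ : ∀ {n} (a b : Monomial n) x → ⟦ zipWith _+_ a b ⟧ₘ x ≡ ⟦ a ⟧ₘ x ∧ ⟦ b ⟧ₘ x
⟦zipWith-+⟧ₘ []      []      x = refl
⟦zipWith-+⟧ₘ (e ∷ a) (f ∷ b) x = trans
  (cong₂ _∧_ (^ᵇ-+ (x zero) e f) (⟦zipWith-+⟧ₘ a b (x ∘ suc)))
  (∧-interchange (x zero ^ᵇ e) (x zero ^ᵇ f) (⟦ a ⟧ₘ (x ∘ suc)) (⟦ b ⟧ₘ (x ∘ suc)))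

⟦⟧-⊗ : ∀ {n} (p q : Poly n) x → ⟦ p ⊗ q ⟧ x ≡ ⟦ p ⟧ x ∧ ⟦ q ⟧ x
⟦⟧-⊗ []      q x = refl
⟦⟧-⊗ (a ∷ p) q x = begin
  ⟦ map (zipWith _+_ a) q ++ p ⊗ q ⟧ x            ≡⟨ ⟦⟧-++ (map (zipWith _+_ a) q) (p ⊗ q) x ⟩
  ⟦ map (zipWith _+_ a) q ⟧ x xor ⟦ p ⊗ q ⟧ x     ≡⟨ cong₂ _xor_ (shift q) (⟦⟧-⊗ p q x) ⟩
  (⟦ a ⟧ₘ x ∧ ⟦ q ⟧ x) xor (⟦ p ⟧ x ∧ ⟦ q ⟧ x)     ≡⟨ sym (∧-distribʳ-xor (⟦ q ⟧ x) (⟦ a ⟧ₘ x) (⟦ p ⟧ x)) ⟩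
  (⟦ a ⟧ₘ x xor ⟦ p ⟧ x) ∧ ⟦ q ⟧ x                ∎
  where
  open ≡-Reasoning
  shift : ∀ q → ⟦ map (zipWith _+_ a) q ⟧ x ≡ ⟦ a ⟧ₘ x ∧ ⟦ q ⟧ x
  shift []      = sym (∧-zeroʳ _)
  shift (b ∷ q) = trans (cong₂ _xor_ (⟦zipWith-+⟧ₘ a b x) (shift q))
                        (sym (∧-distribˡ-xor (⟦ a ⟧ₘ x) (⟦ b ⟧ₘ x) (⟦ q ⟧ x)))

⟦replicate-0⟧ₘ : ∀ {n} (x : Bits n) → ⟦ replicate n 0 ⟧ₘ x ≡ true
⟦replicate-0⟧ₘ {zero}  x = refl
⟦replicate-0⟧ₘ {suc n} x = ⟦replicate-0⟧ₘ (x ∘ suc)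

⟦one⟧ : ∀ {n} (x : Bits n) → ⟦ one ⟧ x ≡ true
⟦one⟧ x = trans (xor-identityʳ _) (⟦replicate-0⟧ₘ x)

⟦var⟧ₘ : ∀ {n} (k : Fin n) x → ⟦ var k ⟧ₘ x ≡ x k
⟦var⟧ₘ {suc n} zero    x = trans (cong₂ _∧_ (∧-identityʳ (x zero)) (zeros (x ∘ suc))) (∧-identityʳ (x zero))
  where
  zeros : ∀ {n} (x : Bits n) → ⟦ tabulate (λ _ → 0) ⟧ₘ x ≡ true
  zeros {zero}  x = refl
  zeros {suc n} x = zeros (x ∘ suc)
⟦var⟧ₘ {suc n} (suc k) x = ⟦var⟧ₘ k (x ∘ suc)

⟦single⟧ : ∀ {n} b (m : Monomial n) x → ⟦ if b then m ∷ [] else [] ⟧ x ≡ b ∧ ⟦ m ⟧ₘ x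
⟦single⟧ true  m x = xor-identityʳ _
⟦single⟧ false m x = refl

⟦concatMap-tabulate⟧ : ∀ {n m} {A : Set} (f : A → Poly n) (h : Fin m → A) x →
                       ⟦ concatMap f (List.tabulate h) ⟧ x ≡ ⨁ (λ k → ⟦ f (h k) ⟧ x)
⟦concatMap-tabulate⟧ {m = zero}  f h x = refl
⟦concatMap-tabulate⟧ {m = suc m} f h x =
  trans (⟦⟧-++ (f (h zero)) _ x) (cong (⟦ f (h zero) ⟧ x xor_) (⟦concatMap-tabulate⟧ f (h ∘ suc) x))

⟦concatMap-allFin⟧ : ∀ {n m} (f : Fin m → Poly n) x → ⟦ concatMap f (allFin m) ⟧ x ≡ ⨁ (λ k → ⟦ f k ⟧ x)
⟦concatMap-allFin⟧ f = ⟦concatMap-tabulate⟧ f (λ k → k)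

⟦evalLin⟧ : ∀ {n} a₀ (a : Bits n) x → ⟦ evalLin (linForm a₀ a) ⟧ x ≡ a₀ xor (a · x)
⟦evalLin⟧ {n} a₀ a x = trans (⟦⟧-++ (if a₀ then one else []) variables x) (cong₂ _xor_ (constant a₀) linear)
  where
  variables : Poly n
  variables = concatMap (λ k → if a k then var k ∷ [] else []) (allFin n)
  constant : ∀ b → ⟦ if b then one else [] ⟧ x ≡ b
  constant true  = ⟦one⟧ x
  constant false = refl
  linear : ⟦ variables ⟧ x ≡ (a · x)
  linear = trans (⟦concatMap-allFin⟧ (λ k → if a k then var k ∷ [] else []) x)
                 (⨁-cong (λ k → trans (⟦single⟧ (a k) (var k) x) (cong (a k ∧_) (⟦var⟧ₘ k x))))

_<ᵇ_ : ∀ {n} → Fin n → Fin n → Bool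
i <ᵇ j = does (i <? j)

s2 : ∀ {n} → Bits n → Bool
s2 x = ⨁ (λ i → ⨁ (λ j → (i <ᵇ j) ∧ (x i ∧ x j)))

⟦S2⟧ : ∀ n (x : Bits n) → ⟦ S2 n ⟧ x ≡ s2 x
⟦S2⟧ n x = trans (⟦concatMap-allFin⟧ row x) (⨁-cong (λ i → trans (⟦concatMap-allFin⟧ (entry i) x)
  (⨁-cong (λ j → trans (⟦single⟧ (i <ᵇ j) (zipWith _+_ (var i) (var j)) x)
    (cong ((i <ᵇ j) ∧_) (trans (⟦zipWith-+⟧ₘ (var i) (var j) x) (cong₂ _∧_ (⟦var⟧ₘ i x) (⟦var⟧ₘ j x))))))))
  where
  entry : Fin n → Fin n → Poly n
  entry i j = if i <ᵇ j then zipWith _+_ (var i) (var j) ∷ [] else []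
  row : Fin n → Poly n
  row i = concatMap (entry i) (allFin n)

record Affine (n : ℕ) : Set where
  constructor affine
  field
    dim         : ℕ
    basis       : Fin dim → Bits n
    offset      : Bits n
    independent : Independent basis

open Affine

point : ∀ {n} (s : Affine n) → Bits (dim s) → Bits n
point s y = offset s ⊻ lincomb y (basis s)

record _⊆_ {n} (t s : Affine n) : Set where
  constructor reparametrised
  field reparametrise : ∀ y → ∃ λ z → point t y ≗ point s z

open _⊆_

⊆-refl : ∀ {n} {s : Affine n} → s ⊆ s
⊆-refl = reparametrised λ y → y , λ _ → refl

⊆-trans : ∀ {n} {s t u : Affine n} → u ⊆ t → t ⊆ s → u ⊆ s
⊆-trans u⊆t t⊆s = reparametrised λ y →
  let (z , eq) = reparametrise u⊆t y ; (w , eq′) = reparametrise t⊆s z in w , λ i → trans (eq i) (eq′ i)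

ConstantOn : ∀ {n} → (Bits n → Bool) → Affine n → Set
ConstantOn f s = ∀ y z → f (point s y) ≡ f (point s z)

constantOn-⊆ : ∀ {n} (p : Poly n) {s t : Affine n} → t ⊆ s → ConstantOn ⟦ p ⟧ s → ConstantOn ⟦ p ⟧ t
constantOn-⊆ p t⊆s const y z with reparametrise t⊆s y | reparametrise t⊆s z
... | y′ , eq | z′ , eq′ = trans (⟦⟧-cong p eq) (trans (const y′ z′) (sym (⟦⟧-cong p eq′)))

·-point : ∀ {n} (a : Bits n) s y → (a · point s y) ≡ (a · offset s) xor ⨁ (λ j → y j ∧ (a · basis s j))
·-point a s y = trans (·-⊻ʳ a (offset s) (lincomb y (basis s))) (cong ((a · offset s) xor_) (·-lincomb a y (basis s)))

hyperplane : ∀ {n} a₀ (a : Bits n) (s : Affine n) (j₀ : Fin (dim s)) → (a · basis s j₀) ≡ true →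
             Σ (Affine n) λ h → h ⊆ s × suc (dim h) ≡ dim s × (∀ y → (a₀ xor (a · point h y)) ≡ false)
hyperplane {n} a₀ a (affine (suc m) A b indA) j₀ a·Aj₀≡1 = h , h⊆s , refl , vanishes
  where
  open ≡-Reasoning
  c : Bits m
  c j = a · A (punchIn j₀ j)
  c₀ : Bool
  c₀ = a₀ xor (a · b)
  h : Affine n
  h = affine m (eliminate A j₀ c) (b ⊻ c₀ ⋆ A j₀) (eliminate-independent A indA j₀ c)

  h⊆s : h ⊆ affine (suc m) A b indA
  h⊆s = reparametrised λ y → insertAt y j₀ (c₀ xor (y · c)) , λ i → begin
    (b i xor (c₀ ∧ A j₀ i)) xor lincomb y (eliminate A j₀ c) i
      ≡⟨ cong ((b i xor (c₀ ∧ A j₀ i)) xor_) (trans (lincomb-eliminate A j₀ c y i) (lincomb-insertAt A j₀ y (y · c) i)) ⟩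
    (b i xor (c₀ ∧ A j₀ i)) xor (((y · c) ∧ A j₀ i) xor lincomb y (A ∘ punchIn j₀) i)
      ≡⟨ merge (b i) c₀ (y · c) (A j₀ i) (lincomb y (A ∘ punchIn j₀) i) ⟩
    b i xor (((c₀ xor (y · c)) ∧ A j₀ i) xor lincomb y (A ∘ punchIn j₀) i)
      ≡⟨ cong (b i xor_) (sym (lincomb-insertAt A j₀ y (c₀ xor (y · c)) i)) ⟩
    b i xor lincomb (insertAt y j₀ (c₀ xor (y · c))) A i
      ∎
    where
    merge : ∀ b c t x r → (b xor (c ∧ x)) xor ((t ∧ x) xor r) ≡ b xor (((c xor t) ∧ x) xor r)
    merge = solve-∀ 𝔽₂

  a⊥basis : ∀ j → (a · eliminate A j₀ c j) ≡ false
  a⊥basis j = begin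
    (a · A (punchIn j₀ j) ⊻ c j ⋆ A j₀)  ≡⟨ ·-⊻ʳ a (A (punchIn j₀ j)) (c j ⋆ A j₀) ⟩
    c j xor (a · c j ⋆ A j₀)             ≡⟨ cong (c j xor_) (trans (·-⋆ʳ a (c j) (A j₀)) (cong (c j ∧_) a·Aj₀≡1)) ⟩
    c j xor (c j ∧ true)                 ≡⟨ xor-cancel-∧ (c j) ⟩
    false                                ∎

  vanishes : ∀ y → (a₀ xor (a · point h y)) ≡ false
  vanishes y = begin
    a₀ xor (a · point h y)
      ≡⟨ cong (a₀ xor_) (·-point a h y) ⟩
    a₀ xor ((a · b ⊻ c₀ ⋆ A j₀) xor ⨁ (λ j → y j ∧ (a · eliminate A j₀ c j)))
      ≡⟨ cong₂ (λ u v → a₀ xor (u xor v)) a·offset (⨁-zero (λ j → ∧-vanishes (a⊥basis j))) ⟩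
    a₀ xor (((a · b) xor c₀) xor false)
      ≡⟨ cong (a₀ xor_) (xor-identityʳ _) ⟩
    a₀ xor ((a · b) xor (a₀ xor (a · b)))
      ≡⟨ xor-cancelˡ a₀ (a · b) (a · b) ⟩
    (a · b) xor (a · b)
      ≡⟨ xor-same (a · b) ⟩
    false
      ∎
    where
    a·offset : (a · b ⊻ c₀ ⋆ A j₀) ≡ (a · b) xor c₀
    a·offset = trans (·-⊻ʳ a b (c₀ ⋆ A j₀))
                     (cong ((a · b) xor_) (trans (·-⋆ʳ a c₀ (A j₀)) (trans (cong (c₀ ∧_) a·Aj₀≡1) (∧-identityʳ c₀))))

record ConstantSubspace {n} (f : Bits n → Bool) (s : Affine n) (k : ℕ) : Set where
  field
    subspace   : Affine n
    subspace⊆s : subspace ⊆ s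
    codim≤     : dim s ≤ k + dim subspace
    constant   : ConstantOn f subspace

gate-constantSubspace : ∀ {n} (g : List (LinForm n)) (s : Affine n) → ConstantSubspace ⟦ evalGate g ⟧ s 1
gate-constantSubspace [] s = record
  { subspace = s ; subspace⊆s = ⊆-refl ; codim≤ = ℕ.n≤1+n (dim s)
  ; constant = λ y z → trans (⟦one⟧ (point s y)) (sym (⟦one⟧ (point s z))) }
gate-constantSubspace (linForm a₀ a ∷ Ls) s with any? (λ j → (a · basis s j) ≟ᵇ true)
... | yes (j₀ , a·Aj₀≡1) with hyperplane a₀ a s j₀ a·Aj₀≡1
...   | h , h⊆s , dim≡ , vanishes = record
  { subspace = h ; subspace⊆s = h⊆s ; codim≤ = ℕ.≤-reflexive (sym dim≡)
  ; constant = λ y z → trans (gate-vanishes y) (sym (gate-vanishes z)) }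
  where
  gate-vanishes : ∀ y → ⟦ evalGate (linForm a₀ a ∷ Ls) ⟧ (point h y) ≡ false
  gate-vanishes y = trans (⟦⟧-⊗ (evalLin (linForm a₀ a)) (evalGate Ls) (point h y))
                          (cong (_∧ ⟦ evalGate Ls ⟧ (point h y)) (trans (⟦evalLin⟧ a₀ a (point h y)) (vanishes y)))
gate-constantSubspace (L@(linForm a₀ a) ∷ Ls) s | no a⊥basis = record
  { subspace = subspace ; subspace⊆s = subspace⊆s ; codim≤ = codim≤
  ; constant = λ y z → trans (⟦⟧-⊗ (evalLin L) (evalGate Ls) (point subspace y))
      (trans (cong₂ _∧_ (constantOn-⊆ (evalLin L) subspace⊆s L-constant y z) (constant y z))
             (sym (⟦⟧-⊗ (evalLin L) (evalGate Ls) (point subspace z)))) }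
  where
  open ConstantSubspace (gate-constantSubspace Ls s)
  a·point : ∀ y → (a · point s y) ≡ (a · offset s)
  a·point y = trans (·-point a s y) (trans (cong ((a · offset s) xor_)
    (⨁-zero (λ j → ∧-vanishes (¬-not (λ a·Aj≡1 → a⊥basis (j , a·Aj≡1)))))) (xor-identityʳ _))
  L-constant : ConstantOn ⟦ evalLin L ⟧ s
  L-constant y z = begin
    ⟦ evalLin L ⟧ (point s y)  ≡⟨ ⟦evalLin⟧ a₀ a (point s y) ⟩
    a₀ xor (a · point s y)     ≡⟨ cong (a₀ xor_) (trans (a·point y) (sym (a·point z))) ⟩
    a₀ xor (a · point s z)     ≡⟨ sym (⟦evalLin⟧ a₀ a (point s z)) ⟩
    ⟦ evalLin L ⟧ (point s z)  ∎
    where open ≡-Reasoning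

circuit-constantSubspace : ∀ {n} (C : Circuit n) (s : Affine n) → ConstantSubspace ⟦ evalCircuit C ⟧ s (gates C)
circuit-constantSubspace [] s = record
  { subspace = s ; subspace⊆s = ⊆-refl ; codim≤ = ℕ.≤-refl ; constant = λ _ _ → refl }
circuit-constantSubspace (g ∷ C) s = record
  { subspace = R.subspace
  ; subspace⊆s = ⊆-trans R.subspace⊆s G.subspace⊆s
  ; codim≤ = ℕ.≤-trans G.codim≤ (s≤s R.codim≤)
  ; constant = λ y z → trans (⟦⟧-++ (evalGate g) (evalCircuit C) (point R.subspace y))
      (trans (cong₂ _xor_ (constantOn-⊆ (evalGate g) R.subspace⊆s G.constant y z) (R.constant y z))
             (sym (⟦⟧-++ (evalGate g) (evalCircuit C) (point R.subspace z)))) }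
  where
  module G = ConstantSubspace (gate-constantSubspace g s)
  module R = ConstantSubspace (circuit-constantSubspace C G.subspace)

unit : ∀ {n} → Fin n → Bits n
unit j i = δ i j

unit-independent : ∀ {n} → Independent (unit {n})
unit-independent S comb≡𝟎 i =
  trans (sym (trans (⨁-cong (λ j → ∧-comm (S j) (δ i j))) (⨁-δ i S))) (comb≡𝟎 i)

whole : ∀ n → Affine n
whole n = affine n unit 𝟎 unit-independent

computes⇒constantSubspace : ∀ {n} (C : Circuit n) → Computes C (S2 n) → ConstantSubspace s2 (whole n) (gates C)
computes⇒constantSubspace {n} C C≈S2 = record
  { subspace = subspace ; subspace⊆s = subspace⊆s ; codim≤ = codim≤
  ; constant = λ y z → trans (sym (⟦C⟧≡s2 (point subspace y))) (trans (constant y z) (⟦C⟧≡s2 (point subspace z))) }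
  where
  open ConstantSubspace (circuit-constantSubspace C (whole n))
  ⟦C⟧≡s2 : ∀ x → ⟦ evalCircuit C ⟧ x ≡ s2 x
  ⟦C⟧≡s2 x = trans (⟦⟧-≈ (evalCircuit C) (S2 n) C≈S2 x) (⟦S2⟧ n x)

⨁² : ∀ {n} → (Fin n → Fin n → Bool) → Bool
⨁² f = ⨁ (λ i → ⨁ (f i))

⨁²-cong : ∀ {n} {f g : Fin n → Fin n → Bool} → (∀ i j → f i j ≡ g i j) → ⨁² f ≡ ⨁² g
⨁²-cong f≡g = ⨁-cong (λ i → ⨁-cong (f≡g i))

⨁²-xor : ∀ {n} (f g : Fin n → Fin n → Bool) → ⨁² (λ i j → f i j xor g i j) ≡ ⨁² f xor ⨁² g
⨁²-xor f g = trans (⨁-cong (λ i → ⨁-xor (f i) (g i))) (⨁-xor (λ i → ⨁ (f i)) (λ i → ⨁ (g i)))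

s2-cong : ∀ {n} {x y : Bits n} → x ≗ y → s2 x ≡ s2 y
s2-cong x≗y = ⨁²-cong (λ i j → cong₂ (λ a b → (i <ᵇ j) ∧ (a ∧ b)) (x≗y i) (x≗y j))

β : ∀ {n} → Bits n → Bits n → Bool
β x y = (x · y) xor (⨁ x ∧ ⨁ y)

β-⊻ˡ : ∀ {n} (x x′ y : Bits n) → β (x ⊻ x′) y ≡ β x y xor β x′ y
β-⊻ˡ x x′ y = trans (cong₂ _xor_ (·-⊻ˡ x x′ y)
                                  (trans (cong (_∧ ⨁ y) (⨁-xor x x′)) (∧-distribʳ-xor (⨁ y) (⨁ x) (⨁ x′))))
                    (xor-interchange (x · y) (x′ · y) (⨁ x ∧ ⨁ y) (⨁ x′ ∧ ⨁ y))

<ᵇ-xor-flip : ∀ {n} (i j : Fin n) → (i <ᵇ j) xor (j <ᵇ i) ≡ not (δ i j)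
<ᵇ-xor-flip zero    zero    = refl
<ᵇ-xor-flip zero    (suc j) = refl
<ᵇ-xor-flip (suc i) zero    = refl
<ᵇ-xor-flip (suc i) (suc j) = <ᵇ-xor-flip i j

-- The mixed terms of s2 (x ⊻ y) sum over all ordered pairs i ≠ j.
s2-mixed : ∀ {n} (x y : Bits n) →
           ⨁² (λ i j → (i <ᵇ j) ∧ (x i ∧ y j)) xor ⨁² (λ i j → (i <ᵇ j) ∧ (y i ∧ x j)) ≡ β x y
s2-mixed x y = begin
  ⨁² (λ i j → (i <ᵇ j) ∧ (x i ∧ y j)) xor ⨁² (λ i j → (i <ᵇ j) ∧ (y i ∧ x j))
    ≡⟨ cong (⨁² (λ i j → (i <ᵇ j) ∧ (x i ∧ y j)) xor_) (trans (⨁-swap (λ i j → (i <ᵇ j) ∧ (y i ∧ x j)))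
         (⨁²-cong (λ j i → cong ((i <ᵇ j) ∧_) (∧-comm (y i) (x j))))) ⟩
  ⨁² (λ i j → (i <ᵇ j) ∧ (x i ∧ y j)) xor ⨁² (λ i j → (j <ᵇ i) ∧ (x i ∧ y j))
    ≡⟨ sym (⨁²-xor (λ i j → (i <ᵇ j) ∧ (x i ∧ y j)) (λ i j → (j <ᵇ i) ∧ (x i ∧ y j))) ⟩
  ⨁² (λ i j → ((i <ᵇ j) ∧ (x i ∧ y j)) xor ((j <ᵇ i) ∧ (x i ∧ y j)))
    ≡⟨ ⨁²-cong (λ i j → trans (sym (∧-distribʳ-xor (x i ∧ y j) (i <ᵇ j) (j <ᵇ i)))
                              (trans (cong (_∧ (x i ∧ y j)) (<ᵇ-xor-flip i j)) (not-∧ (δ i j) (x i ∧ y j)))) ⟩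
  ⨁² (λ i j → (x i ∧ y j) xor (δ i j ∧ (x i ∧ y j)))
    ≡⟨ ⨁²-xor (λ i j → x i ∧ y j) (λ i j → δ i j ∧ (x i ∧ y j)) ⟩
  ⨁² (λ i j → x i ∧ y j) xor ⨁² (λ i j → δ i j ∧ (x i ∧ y j))
    ≡⟨ cong₂ _xor_ (trans (⨁-cong (λ i → ⨁-∧ˡ (x i) y)) (⨁-∧ʳ (⨁ y) x)) (⨁-cong (λ i → ⨁-δ i (λ j → x i ∧ y j))) ⟩
  (⨁ x ∧ ⨁ y) xor (x · y)
    ≡⟨ xor-comm (⨁ x ∧ ⨁ y) (x · y) ⟩
  β x y
    ∎
  where
  open ≡-Reasoning
  not-∧ : ∀ e z → not e ∧ z ≡ z xor (e ∧ z)
  not-∧ false z = sym (xor-identityʳ z)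
  not-∧ true  z = sym (xor-same z)

s2-⊻ : ∀ {n} (x y : Bits n) → s2 (x ⊻ y) ≡ (s2 x xor s2 y) xor β x y
s2-⊻ x y = begin
  s2 (x ⊻ y)
    ≡⟨ ⨁²-cong (λ i j → expand (i <ᵇ j) (x i) (y i) (x j) (y j)) ⟩
  ⨁² (λ i j → (XX i j xor YY i j) xor (XY i j xor YX i j))
    ≡⟨ ⨁²-xor (λ i j → XX i j xor YY i j) (λ i j → XY i j xor YX i j) ⟩
  ⨁² (λ i j → XX i j xor YY i j) xor ⨁² (λ i j → XY i j xor YX i j)
    ≡⟨ cong₂ _xor_ (⨁²-xor XX YY) (trans (⨁²-xor XY YX) (s2-mixed x y)) ⟩
  (s2 x xor s2 y) xor β x y
    ∎
  where
  open ≡-Reasoning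
  XX YY XY YX : Fin _ → Fin _ → Bool
  XX i j = (i <ᵇ j) ∧ (x i ∧ x j)
  YY i j = (i <ᵇ j) ∧ (y i ∧ y j)
  XY i j = (i <ᵇ j) ∧ (x i ∧ y j)
  YX i j = (i <ᵇ j) ∧ (y i ∧ x j)
  expand : ∀ l a b c d → l ∧ ((a xor b) ∧ (c xor d)) ≡
           ((l ∧ (a ∧ c)) xor (l ∧ (b ∧ d))) xor ((l ∧ (a ∧ d)) xor (l ∧ (b ∧ c)))
  expand = solve-∀ 𝔽₂

xor-identityʳ-unique : ∀ a b → a xor b ≡ a → b ≡ false
xor-identityʳ-unique false b eq = eq
xor-identityʳ-unique true  b eq = trans (sym (not-involutive b)) (cong not eq)

Isotropic : ∀ {m n} → (Fin m → Bits n) → Set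
Isotropic A = ∀ j k → β (A j) (A k) ≡ false

𝟏 : ∀ {n} → Bits n
𝟏 _ = true

parity : ℕ → Bool
parity n = ⨁ (𝟏 {n})

OnesInSpan : ∀ {m n} → (Fin m → Bits n) → Set
OnesInSpan {m} A = ∃ λ (S : Bits m) → lincomb S A ≗ 𝟏

onesInSpan? : ∀ {m n} (A : Fin m → Bits n) → Dec (OnesInSpan A)
onesInSpan? A with anySubset? (λ S → all? (λ i → lincomb (Vec.lookup S) A i ≟ᵇ true))
... | yes (S , S↦𝟏) = yes (Vec.lookup S , S↦𝟏)
... | no none       = no λ (S , S↦𝟏) →
  none (Vec.tabulate S , λ i → trans (lincomb-cong A (Vec.lookup∘tabulate S) i) (S↦𝟏 i))

·-𝟏 : ∀ {n} (x : Bits n) → (x · 𝟏) ≡ ⨁ x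
·-𝟏 x = ⨁-cong (λ i → ∧-identityʳ (x i))

module _ {n} (s : Affine n) (const : ConstantOn s2 s) where

  private
    b = offset s
    A = basis s

  s2-translate : ∀ {x} S → x ≗ lincomb S A → s2 (b ⊻ x) ≡ s2 b
  s2-translate S x≗comb = begin
    s2 (b ⊻ _)           ≡⟨ s2-cong (λ i → cong (b i xor_) (x≗comb i)) ⟩
    s2 (point s S)       ≡⟨ const S 𝟎 ⟩
    s2 (point s 𝟎)       ≡⟨ s2-cong (λ i → trans (cong (b i xor_) (lincomb-𝟎 A i)) (xor-identityʳ (b i))) ⟩
    s2 b                 ∎
    where open ≡-Reasoning

  -- β is the second difference of s2, so it vanishes where s2 is constant.
  constant⇒isotropic : Isotropic A
  constant⇒isotropic j k = xor-identityʳ-unique (s2 b) (β (A j) (A k)) (begin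
    s2 b xor β (A j) (A k)
      ≡⟨ cong (_xor β (A j) (A k)) (sym (s2-translate (δ k) (sym ∘ lincomb-δ A k))) ⟩
    s2 (b ⊻ A k) xor β (A j) (A k)
      ≡⟨ cong (_xor β (A j) (A k)) (s2-⊻ b (A k)) ⟩
    ((s2 b xor s2 (A k)) xor β b (A k)) xor β (A j) (A k)
      ≡⟨ xor-assoc (s2 b xor s2 (A k)) (β b (A k)) (β (A j) (A k)) ⟩
    (s2 b xor s2 (A k)) xor (β b (A k) xor β (A j) (A k))
      ≡⟨ cong₂ (λ u v → (u xor s2 (A k)) xor v) (sym (s2-translate (δ j) (sym ∘ lincomb-δ A j)))
                                                (sym (β-⊻ˡ b (A j) (A k))) ⟩
    (s2 (b ⊻ A j) xor s2 (A k)) xor β (b ⊻ A j) (A k)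
      ≡⟨ sym (s2-⊻ (b ⊻ A j) (A k)) ⟩
    s2 ((b ⊻ A j) ⊻ A k)
      ≡⟨ s2-cong (λ i → xor-assoc (b i) (A j i) (A k i)) ⟩
    s2 (b ⊻ (A j ⊻ A k))
      ≡⟨ s2-translate (δ j ⊻ δ k) (λ i → sym (trans (lincomb-⊻ A (δ j) (δ k) i)
                                                    (cong₂ _xor_ (lincomb-δ A j i) (lincomb-δ A k i)))) ⟩
    s2 b
      ∎)
    where open ≡-Reasoning

  -- For odd n, β b 𝟏 = 0, so translating by 𝟏 changes s2 by exactly s2 𝟏.
  ones∈span⇒s2-𝟏≡false : OnesInSpan A → parity n ≡ true → s2 (𝟏 {n}) ≡ false
  ones∈span⇒s2-𝟏≡false (S , S↦𝟏) odd = xor-identityʳ-unique (s2 b) (s2 ones) (begin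
    s2 b xor s2 ones                  ≡⟨ sym (xor-identityʳ _) ⟩
    (s2 b xor s2 ones) xor false      ≡⟨ cong ((s2 b xor s2 ones) xor_) (sym β-b-𝟏) ⟩
    (s2 b xor s2 ones) xor β b ones   ≡⟨ sym (s2-⊻ b ones) ⟩
    s2 (b ⊻ ones)                     ≡⟨ s2-translate S (sym ∘ S↦𝟏) ⟩
    s2 b                              ∎)
    where
    open ≡-Reasoning
    ones = 𝟏 {n}
    β-b-𝟏 : β b ones ≡ false
    β-b-𝟏 = trans (cong₂ (λ u v → u xor (⨁ b ∧ v)) (·-𝟏 b) odd) (xor-cancel-∧ (⨁ b))

gram : ∀ {n} → Bits n → Bits n
gram v i = v i xor ⨁ v

·-gram : ∀ {n} (u v : Bits n) → (u · gram v) ≡ β u v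
·-gram u v = trans (·-⊻ʳ u v (λ _ → ⨁ v)) (cong ((u · v) xor_) (⨁-∧ʳ (⨁ v) u))

lincomb-gram : ∀ {m n} (S : Bits m) (A : Fin m → Bits n) → lincomb S (gram ∘ A) ≗ gram (lincomb S A)
lincomb-gram S A i = begin
  ⨁ (λ j → S j ∧ (A j i xor ⨁ (A j)))
    ≡⟨ ⨁-cong (λ j → ∧-distribˡ-xor (S j) (A j i) (⨁ (A j))) ⟩
  ⨁ (λ j → (S j ∧ A j i) xor (S j ∧ ⨁ (A j)))
    ≡⟨ ⨁-xor (λ j → S j ∧ A j i) (λ j → S j ∧ ⨁ (A j)) ⟩
  lincomb S A i xor ⨁ (λ j → S j ∧ ⨁ (A j))
    ≡⟨ cong (lincomb S A i xor_) (trans (⨁-cong (λ j → sym (⨁-∧ˡ (S j) (A j)))) (⨁-swap (λ j i → S j ∧ A j i))) ⟩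
  lincomb S A i xor ⨁ (lincomb S A)
    ∎
  where open ≡-Reasoning

-- gram w = 𝟎 forces w = 𝟎, or w = 𝟏 with ⨁ w = 1; the hypothesis excludes the latter.
gram-independent : ∀ {m n} (A : Fin m → Bits n) → Independent A →
                   (OnesInSpan A → parity n ≡ false) → Independent (gram ∘ A)
gram-independent {n = n} A indA 𝟏∈span⇒even S comb≡𝟎 = by-weight (⨁ (lincomb S A)) refl
  where
  w≡⨁w : ∀ i → lincomb S A i ≡ ⨁ (lincomb S A)
  w≡⨁w i = xor≡false⇒≡ (trans (sym (lincomb-gram S A i)) (comb≡𝟎 i))
  by-weight : ∀ c → ⨁ (lincomb S A) ≡ c → S ≗ 𝟎
  by-weight false ⨁w≡0 = indA S (λ i → trans (w≡⨁w i) ⨁w≡0)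
  by-weight true  ⨁w≡1 = ⊥-elim (true≢false (begin
    true                  ≡⟨ sym ⨁w≡1 ⟩
    ⨁ (lincomb S A)       ≡⟨ ⨁-cong (λ i → trans (w≡⨁w i) ⨁w≡1) ⟩
    parity n              ≡⟨ 𝟏∈span⇒even (S , λ i → trans (w≡⨁w i) ⨁w≡1) ⟩
    false                 ∎))
    where open ≡-Reasoning

isotropic⇒+≤ : ∀ {m n} (A : Fin m → Bits n) → Independent A → Isotropic A →
               (OnesInSpan A → parity n ≡ false) → m + m ≤ n
isotropic⇒+≤ A indA iso 𝟏∈span⇒even = orthogonal⇒+≤ A (gram ∘ A) indA (gram-independent A indA 𝟏∈span⇒even)
  (λ j k → trans (·-gram (A j) (A k)) (iso j k))

-- If 𝟏 is in the span, drop a basis vector that its expansion uses.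
ones∈span⇒+≤ : ∀ {m n} (A : Fin m → Bits n) → Independent A → Isotropic A →
                OnesInSpan A → parity n ≡ true → m + m ≤ 2 + n
ones∈span⇒+≤ {n = n} A indA iso (S , S↦𝟏) odd with any? (λ j → S j ≟ᵇ true)
... | no unused = ⊥-elim (true≢false (begin
    true                  ≡⟨ sym odd ⟩
    parity n              ≡⟨ sym (⨁-cong S↦𝟏) ⟩
    ⨁ (lincomb S A)       ≡⟨ ⨁-zero (λ i → trans (lincomb-cong A S≗𝟎 i) (lincomb-𝟎 A i)) ⟩
    false                 ∎))
  where
  open ≡-Reasoning
  S≗𝟎 : S ≗ 𝟎
  S≗𝟎 j = ¬-not (λ Sj≡1 → unused (j , Sj≡1))
ones∈span⇒+≤ {suc m} {n} A indA iso (S , S↦𝟏) odd | yes (j₀ , Sj₀≡1) =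
  subst (_≤ 2 + n) (cong suc (sym (ℕ.+-suc m m)))
        (s≤s (s≤s (isotropic⇒+≤ A′ (punchIn-independent A indA j₀) (λ j k → iso (punchIn j₀ j) (punchIn j₀ k))
                                 (λ 𝟏∈span′ → ⊥-elim (𝟏∉span′ 𝟏∈span′)))))
  where
  A′ = A ∘ punchIn j₀
  𝟏∉span′ : ¬ OnesInSpan A′
  𝟏∉span′ (T , T↦𝟏) = true≢false (begin
    true                                    ≡⟨ sym (trans (xor-identityʳ (S j₀)) Sj₀≡1) ⟩
    S j₀ xor false                          ≡⟨ cong (S j₀ xor_) (sym (insertAt-lookup T j₀ false)) ⟩
    (S ⊻ insertAt T j₀ false) j₀            ≡⟨ indA (S ⊻ insertAt T j₀ false) cancels j₀ ⟩
    false                                   ∎)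
    where
    open ≡-Reasoning
    cancels : lincomb (S ⊻ insertAt T j₀ false) A ≗ 𝟎
    cancels i = begin
      lincomb (S ⊻ insertAt T j₀ false) A i               ≡⟨ lincomb-⊻ A S (insertAt T j₀ false) i ⟩
      lincomb S A i xor lincomb (insertAt T j₀ false) A i
        ≡⟨ cong₂ _xor_ (S↦𝟏 i) (trans (lincomb-insertAt A j₀ T false i) (T↦𝟏 i)) ⟩
      false                                               ∎

half : ∀ {m n} → m + m ≤ n → m ≤ ⌊ n /2⌋
half {m} m+m≤n = subst (_≤ _) (sym (ℕ.n≡⌊n+n/2⌋ m)) (ℕ.⌊n/2⌋-mono m+m≤n)

+≤⇒⌈/2⌉+≤ : ∀ {m n} → m + m ≤ n → ⌈ n /2⌉ + m ≤ n
+≤⇒⌈/2⌉+≤ {m} {n} m+m≤n = ℕ.≤-trans (ℕ.+-monoʳ-≤ ⌈ n /2⌉ (half m+m≤n))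
  (ℕ.≤-reflexive (trans (ℕ.+-comm ⌈ n /2⌉ ⌊ n /2⌋) (ℕ.⌊n/2⌋+⌈n/2⌉≡n n)))

parity-+2 : ∀ n → parity (2 + n) ≡ parity n
parity-+2 n = not-involutive (parity n)

odd⇒⌈/2⌉≡1+⌊/2⌋ : ∀ n → parity n ≡ true → ⌈ n /2⌉ ≡ suc ⌊ n /2⌋
odd⇒⌈/2⌉≡1+⌊/2⌋ (suc zero)    _   = refl
odd⇒⌈/2⌉≡1+⌊/2⌋ (suc (suc n)) odd = cong suc (odd⇒⌈/2⌉≡1+⌊/2⌋ n (trans (sym (parity-+2 n)) odd))

odd-+≤⇒⌊/2⌋+≤ : ∀ {m n} → parity n ≡ true → m + m ≤ 2 + n → ⌊ n /2⌋ + m ≤ n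
odd-+≤⇒⌊/2⌋+≤ {m} {n} odd m+m≤2+n = ℕ.≤-trans
  (ℕ.+-monoʳ-≤ ⌊ n /2⌋ (subst (m ≤_) (sym (odd⇒⌈/2⌉≡1+⌊/2⌋ n odd)) (half m+m≤2+n)))
  (ℕ.≤-reflexive (ℕ.⌊n/2⌋+⌈n/2⌉≡n n))

s2-𝟏-+2 : ∀ n → s2 (𝟏 {2 + n}) ≡ not (s2 (𝟏 {n}))
s2-𝟏-+2 n = lemma (parity n) (s2 (𝟏 {n}))
  where
  lemma : ∀ p s → not p xor (p xor s) ≡ not s
  lemma false s = refl
  lemma true  s = refl

-- s2 𝟏 is the parity of n(n-1)/2.
%4≡ᵇ1≡not-s2-𝟏 : ∀ n → parity n ≡ true → (n % 4 ≡ᵇ 1) ≡ not (s2 (𝟏 {n}))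
%4≡ᵇ1≡not-s2-𝟏 1 _ = refl
%4≡ᵇ1≡not-s2-𝟏 3 _ = refl
%4≡ᵇ1≡not-s2-𝟏 (suc (suc (suc (suc n)))) odd = begin
  ((4 + n) % 4 ≡ᵇ 1)        ≡⟨ cong (_≡ᵇ 1) (trans (cong (_% 4) (ℕ.+-comm 4 n)) ([m+n]%n≡m%n n 4)) ⟩
  (n % 4 ≡ᵇ 1)              ≡⟨ %4≡ᵇ1≡not-s2-𝟏 n (trans (sym (trans (parity-+2 (2 + n)) (parity-+2 n))) odd) ⟩
  not (s2 (𝟏 {n}))          ≡⟨ cong not (sym period) ⟩
  not (s2 (𝟏 {4 + n}))      ∎
  where
  open ≡-Reasoning
  period : s2 (𝟏 {4 + n}) ≡ s2 (𝟏 {n})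
  period = trans (s2-𝟏-+2 (2 + n)) (trans (cong not (s2-𝟏-+2 n)) (not-involutive _))

bound≤⌈/2⌉ : ∀ n → bound n ≤ ⌈ n /2⌉
bound≤⌈/2⌉ n with n % 4 ≡ᵇ 1
... | true  = ℕ.⌊n/2⌋≤⌈n/2⌉ n
... | false = ℕ.≤-refl

module _ {n} (s : Affine n) (const : ConstantOn s2 s) where

  private
    A = basis s
    iso = constant⇒isotropic s const

    ⌈/2⌉-bound : dim s + dim s ≤ n → bound n + dim s ≤ n
    ⌈/2⌉-bound 2dim≤n = ℕ.≤-trans (ℕ.+-monoˡ-≤ (dim s) (bound≤⌈/2⌉ n)) (+≤⇒⌈/2⌉+≤ 2dim≤n)

  bound+dim≤ : bound n + dim s ≤ n
  bound+dim≤ with onesInSpan? A | parity n in parity≡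
  ... | no 𝟏∉span | _     = ⌈/2⌉-bound (isotropic⇒+≤ A (independent s) iso (⊥-elim ∘ 𝟏∉span))
  ... | yes _     | false = ⌈/2⌉-bound (isotropic⇒+≤ A (independent s) iso (λ _ → parity≡))
  ... | yes 𝟏∈span | true with n % 4 ≡ᵇ 1 in residue
  ...   | true  = odd-+≤⇒⌊/2⌋+≤ parity≡ (ones∈span⇒+≤ A (independent s) iso 𝟏∈span parity≡)
  ...   | false = ⊥-elim (true≢false (trans (sym s2-𝟏≡true) (ones∈span⇒s2-𝟏≡false s const 𝟏∈span parity≡)))
    where
    s2-𝟏≡true : s2 (𝟏 {n}) ≡ true
    s2-𝟏≡true = trans (sym (not-involutive _)) (cong not (trans (sym (%4≡ᵇ1≡not-s2-𝟏 n parity≡)) residue))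

-- The bound also holds for n = 0.
mainTheorem6 : (n : ℕ) → 1 ≤ n → (C : Circuit n) → Computes C (S2 n) → bound n ≤ gates C
mainTheorem6 n _ C C≈S2 =
  ℕ.+-cancelʳ-≤ (dim subspace) (bound n) (gates C) (ℕ.≤-trans (bound+dim≤ subspace constant) codim≤)
  where open ConstantSubspace (computes⇒constantSubspace C C≈S2)
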